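{- Let $A$ be any skew shape and let $k\ge2$ be an integer. Then $\mathrm{rows}_{k-1}(\mathrm{trim}(A))=\mathrm{rows}_k(A)$.
   Context: A skew shape $\lambda/\mu$ is the set of boxes of the Young diagram of $\lambda$ (English notation) not in that of $\mu\subseteq\lambda$. $\mathrm{trim}(A)$ is the skew shape obtained from $A$ by deleting the top box of every non-empty column of $A$. For a skew shape $A$ with $r$ rows (numbered top to bottom) and $k\ge1$, for $i=1,\ldots,r-k+1$ let $\mathrm{ov}_k(i)$ be the number of columns occupied in common by rows $i,\ldots,i+k-1$; $\mathrm{rows}_k(A)$ is the weakly decreasing rearrangement of $(\mathrm{ov}_k(1),\ldots,\mathrm{ov}_k(r-k+1))$, as a partition (zeros discarded). -}

module Defs where

open import Data.Nat using (ℕ; zero; suc; _≤_; _∸_; _+_; _≤ᵇ_; _<ᵇ_)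
open import Data.Nat.Properties using (≤-decTotalOrder)
open import Data.Bool using (Bool; true; false; _∧_)
open import Data.List using (List; []; _∷_; length; upTo; filter; map; reverse)
open import Data.Bool.ListAction using (all; any)
open import Data.List.Relation.Unary.Linked using (Linked)
open import Data.Nat using (_≥_; _≟_)
open import Relation.Nullary using (¬?)
import Data.List.Sort

-- i-th entry of a partition (0-indexed), 0 beyond its length
_!_ : List ℕ → ℕ → ℕ
[] ! _ = 0
(x ∷ xs) ! zero = x
(x ∷ xs) ! suc i = xs ! i

record IsPartition (λ' : List ℕ) : Set where
  field
    decreasing : Linked _≥_ λ'
    positive   : ∀ i → i Data.Nat.< length λ' → 1 ≤ λ' ! i

record SkewShape : Set where
  field
    outer inner : List ℕ
    outer-partition : IsPartition outer
    inner-partition : IsPartition inner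
    contained : ∀ i → inner ! i ≤ outer ! i

-- A set of boxes (i , j) (row i, column j, both 0-indexed, English notation)
-- together with the number of rows r (rows 0 .. r-1) and a bound on columns.
record Boxes : Set where
  field
    nrows : ℕ
    ncols : ℕ
    box   : ℕ → ℕ → Bool

boxes : SkewShape → Boxes
boxes A = record
  { nrows = length (SkewShape.outer A)
  ; ncols = SkewShape.outer A ! 0
  ; box   = λ i j → (SkewShape.inner A ! i ≤ᵇ j) ∧ (j <ᵇ SkewShape.outer A ! i)
  }

-- trim: delete the top box of every non-empty column, i.e. a box survives
-- iff it is not the top box of its column, i.e. some box of A lies above it
-- in the same column.
trim : Boxes → Boxes
trim B = record
  { nrows = Boxes.nrows B
  ; ncols = Boxes.ncols B
  ; box   = λ i j → Boxes.box B i j ∧ any (λ i' → Boxes.box B i' j) (upTo i)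
  }

ov : ℕ → Boxes → ℕ → ℕ
ov k B i = length (filter (λ j → all (λ t → Boxes.box B (i + t) j) (upTo k) Data.Bool.≟ true)
                          (upTo (Boxes.ncols B)))

-- (ov_k(1), ..., ov_k(r-k+1))  (0-indexed here: i = 0 .. r-k)
ovList : ℕ → Boxes → List ℕ
ovList k B = map (ov k B) (upTo (suc (Boxes.nrows B) ∸ k))

open Data.List.Sort ≤-decTotalOrder using (sort)

rowsK : ℕ → Boxes → List ℕ
rowsK k B = reverse (sort (filter (λ n → ¬? (n ≟ 0)) (ovList k B)))

-- Row i+1 of trim(A) keeps exactly the boxes of row i+1 of A that have a box of A above them;
-- since the columns of a skew shape are intervals, these are the columns shared with row i.
-- Hence k-1 consecutive rows i+1, …, i+k-1 of trim(A) overlap in exactly the columns shared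
-- by the k rows i, …, i+k-1 of A, while row 0 of trim(A) is empty. So the overlap sequence of
-- trim(A) is that of A with one extra leading zero, which rows_{k-1} discards.
module Submission where

open import Defs
open import Data.Nat using (ℕ; zero; suc; _≤_; _<_; _≥_; _+_; _∸_; _≟_; _≤′_; ≤′-refl; ≤′-step; z≤n; s≤s; z<s; s<s)
open import Data.Nat.Properties
  using (≤-refl; ≤-trans; n≤1+n; <-≤-trans; ≤⇒≤′; +-suc; ≤ᵇ⇒≤; ≤⇒≤ᵇ; <ᵇ⇒<; <⇒<ᵇ; ≤-decTotalOrder)
open import Data.Bool using (Bool; true; T)
open import Data.Bool.Properties using (T-∧; T-≡)
open import Data.Bool.ListAction using (all; any)
open import Data.List using (List; _∷_; length; upTo; applyUpTo; filter; map; reverse)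
open import Data.List.Properties using (map-∘; map-cong; map-applyUpTo; filter-≐; filter-none)
open import Data.List.Relation.Unary.Linked using (Linked; []; [-]; _∷_)
import Data.List.Relation.Unary.All.Properties as All
import Data.List.Relation.Unary.Any.Properties as Any
open import Data.List.Sort ≤-decTotalOrder using (sort)
open import Data.Product using (_×_; _,_; proj₁; proj₂; ∃-syntax)
open import Function using (_∘_; id; _⇔_; mk⇔; Equivalence)
open import Relation.Nullary using (¬_; ¬?)
open import Relation.Binary.PropositionalEquality using (_≡_; refl; sym; trans; cong; subst; module ≡-Reasoning)

T-all-upTo : ∀ (p : ℕ → Bool) n → T (all p (upTo n)) ⇔ (∀ {t} → t < n → T (p t))
T-all-upTo p n = mk⇔ (All.applyUpTo⁻ id n ∘ All.all⁺ p (upTo n))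
                     (All.all⁻ p ∘ All.applyUpTo⁺₁ id n)

T-any-upTo : ∀ (p : ℕ → Bool) n → T (any p (upTo n)) ⇔ (∃[ t ] t < n × T (p t))
T-any-upTo p n = mk⇔ (Any.applyUpTo⁻ id ∘ Any.any⁻ p (upTo n))
                     (λ (t , t<n , pt) → Any.any⁺ p (Any.applyUpTo⁺ id pt t<n))

!-suc-≤ : ∀ {xs} → Linked _≥_ xs → ∀ i → xs ! suc i ≤ xs ! i
!-suc-≤ []          i       = z≤n
!-suc-≤ [-]         i       = z≤n
!-suc-≤ (x≥y ∷ _)   zero    = x≥y
!-suc-≤ (_ ∷ ys↘)   (suc i) = !-suc-≤ ys↘ i

!-antitone′ : ∀ {xs i j} → Linked _≥_ xs → i ≤′ j → xs ! j ≤ xs ! i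
!-antitone′ xs↘ ≤′-refl        = ≤-refl
!-antitone′ xs↘ (≤′-step i≤′j) = ≤-trans (!-suc-≤ xs↘ _) (!-antitone′ xs↘ i≤′j)

!-antitone : ∀ {xs i j} → Linked _≥_ xs → i ≤ j → xs ! j ≤ xs ! i
!-antitone xs↘ = !-antitone′ xs↘ ∘ ≤⇒≤′

ColumnConvex : Boxes → Set
ColumnConvex B = ∀ {a b c j} → a ≤ b → b ≤ c →
  T (Boxes.box B a j) → T (Boxes.box B c j) → T (Boxes.box B b j)

boxes-columnConvex : ∀ A → ColumnConvex (boxes A)
boxes-columnConvex A a≤b b≤c a∈ c∈ with Equivalence.to T-∧ a∈ | Equivalence.to T-∧ c∈
... | μa≤j , _ | _ , j<λc = Equivalence.from T-∧
  ( ≤⇒≤ᵇ (≤-trans (!-antitone inner↘ a≤b) (≤ᵇ⇒≤ _ _ μa≤j))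
  , <⇒<ᵇ (<-≤-trans (<ᵇ⇒< _ _ j<λc) (!-antitone outer↘ b≤c)) )
  where
  open SkewShape A
  inner↘ : Linked _≥_ inner
  inner↘ = IsPartition.decreasing inner-partition
  outer↘ : Linked _≥_ outer
  outer↘ = IsPartition.decreasing outer-partition

trim-box-zero : ∀ B j → ¬ T (Boxes.box (trim B) 0 j)
trim-box-zero B j = proj₂ ∘ Equivalence.to T-∧

trim-box-suc : ∀ B → ColumnConvex B → ∀ i j →
  T (Boxes.box (trim B) (suc i) j) ⇔ (T (Boxes.box B i j) × T (Boxes.box B (suc i) j))
trim-box-suc B convex i j = mk⇔ to from
  where
  box : ℕ → ℕ → Bool
  box = Boxes.box B

  to : T (Boxes.box (trim B) (suc i) j) → T (box i j) × T (box (suc i) j)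
  to survives with Equivalence.to T-∧ survives
  ... | here , above with Equivalence.to (T-any-upTo (λ i′ → box i′ j) (suc i)) above
  ... | i′ , s≤s i′≤i , i′∈ = convex i′≤i (n≤1+n i) i′∈ here , here

  from : T (box i j) × T (box (suc i) j) → T (Boxes.box (trim B) (suc i) j)
  from (i∈ , suc-i∈) = Equivalence.from T-∧
    (suc-i∈ , Equivalence.from (T-any-upTo (λ i′ → box i′ j) (suc i)) (i , ≤-refl , i∈))

window : ℕ → Boxes → ℕ → ℕ → Bool
window k B i j = all (λ t → Boxes.box B (i + t) j) (upTo k)

T-window : ∀ k B i j → T (window k B i j) ⇔ (∀ {t} → t < k → T (Boxes.box B (i + t) j))
T-window k B i j = T-all-upTo (λ t → Boxes.box B (i + t) j) k

window-trim-suc : ∀ B → ColumnConvex B → ∀ m i j →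
  T (window (suc m) (trim B) (suc i) j) ⇔ T (window (suc (suc m)) B i j)
window-trim-suc B convex m i j =
  mk⇔ (λ w → Equivalence.from (T-window (suc (suc m)) B i j) (to (Equivalence.to (T-window (suc m) (trim B) (suc i) j) w)))
      (λ w → Equivalence.from (T-window (suc m) (trim B) (suc i) j) (from (Equivalence.to (T-window (suc (suc m)) B i j) w)))
  where
  box : ℕ → Bool
  box r = Boxes.box B r j

  rows-below-above : ∀ t → T (Boxes.box (trim B) (suc (i + t)) j) ⇔ (T (box (i + t)) × T (box (i + suc t)))
  rows-below-above t = subst (λ r → T (Boxes.box (trim B) (suc (i + t)) j) ⇔ (T (box (i + t)) × T (box r))) (sym (+-suc i t)) (trim-box-suc B convex (i + t) j)

  to : (∀ {t} → t < suc m → T (Boxes.box (trim B) (suc i + t) j)) → ∀ {t} → t < suc (suc m) → T (box (i + t))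
  to trimmed {zero}  _         = proj₁ (Equivalence.to (rows-below-above 0) (trimmed z<s))
  to trimmed {suc t} (s<s t<m) = proj₂ (Equivalence.to (rows-below-above t) (trimmed t<m))

  from : (∀ {t} → t < suc (suc m) → T (box (i + t))) → ∀ {t} → t < suc m → T (Boxes.box (trim B) (suc i + t) j)
  from full {t} t<m = Equivalence.from (rows-below-above t) (full (<-≤-trans t<m (n≤1+n (suc m))) , full (s<s t<m))

ov-trim-zero : ∀ k B → ov (suc k) (trim B) 0 ≡ 0
ov-trim-zero k B = cong length (filter-none _ (All.applyUpTo⁺₂ id (Boxes.ncols B) empty))
  where
  empty : ∀ j → ¬ window (suc k) (trim B) 0 j ≡ true
  empty j occupied = trim-box-zero B j (Equivalence.to (T-window (suc k) (trim B) 0 j) (Equivalence.from T-≡ occupied) z<s)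

ov-trim-suc : ∀ B → ColumnConvex B → ∀ m i → ov (suc m) (trim B) (suc i) ≡ ov (suc (suc m)) B i
ov-trim-suc B convex m i = cong length (filter-≐ _ _ (same , same⁻¹) (upTo (Boxes.ncols B)))
  where
  same : ∀ {j} → window (suc m) (trim B) (suc i) j ≡ true → window (suc (suc m)) B i j ≡ true
  same {j} = Equivalence.to T-≡ ∘ Equivalence.to (window-trim-suc B convex m i j) ∘ Equivalence.from T-≡

  same⁻¹ : ∀ {j} → window (suc (suc m)) B i j ≡ true → window (suc m) (trim B) (suc i) j ≡ true
  same⁻¹ {j} = Equivalence.to T-≡ ∘ Equivalence.from (window-trim-suc B convex m i j) ∘ Equivalence.from T-≡

dropZeros : List ℕ → List ℕ
dropZeros = filter (λ n → ¬? (n ≟ 0))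

dropZeros-map-upTo-suc : ∀ (f : ℕ → ℕ) → f 0 ≡ 0 → ∀ n →
  dropZeros (map f (upTo (suc n))) ≡ dropZeros (map (f ∘ suc) (upTo n))
dropZeros-map-upTo-suc f f0≡0 n = begin
  dropZeros (f 0 ∷ map f (applyUpTo suc n))      ≡⟨ cong (λ x → dropZeros (x ∷ map f (applyUpTo suc n))) f0≡0 ⟩
  dropZeros (map f (applyUpTo suc n))            ≡⟨ cong (dropZeros ∘ map f) (sym (map-applyUpTo id suc n)) ⟩
  dropZeros (map f (map suc (upTo n)))           ≡⟨ cong dropZeros (sym (map-∘ (upTo n))) ⟩
  dropZeros (map (f ∘ suc) (upTo n))             ∎
  where open ≡-Reasoning

-- With r rows there are r ∸ m windows of m + 1 rows and r ∸ suc m windows of m + 2 rows.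
dropZeros-shift : ∀ (f g : ℕ → ℕ) → f 0 ≡ 0 → (∀ i → f (suc i) ≡ g i) → ∀ r m →
  dropZeros (map f (upTo (r ∸ m))) ≡ dropZeros (map g (upTo (r ∸ suc m)))
dropZeros-shift f g f0≡0 f∘suc≗g zero    zero    = refl
dropZeros-shift f g f0≡0 f∘suc≗g zero    (suc m) = refl
dropZeros-shift f g f0≡0 f∘suc≗g (suc r) zero    =
  trans (dropZeros-map-upTo-suc f f0≡0 r) (cong dropZeros (map-cong f∘suc≗g (upTo r)))
dropZeros-shift f g f0≡0 f∘suc≗g (suc r) (suc m) = dropZeros-shift f g f0≡0 f∘suc≗g r m

rowsK-trim : ∀ B → ColumnConvex B → ∀ m → rowsK (suc m) (trim B) ≡ rowsK (suc (suc m)) B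
rowsK-trim B convex m = cong (reverse ∘ sort)
  (dropZeros-shift (ov (suc m) (trim B)) (ov (suc (suc m)) B)
    (ov-trim-zero m B) (ov-trim-suc B convex m) (Boxes.nrows B) m)

lemma3p7 : (A : SkewShape) (k : ℕ) → 2 ≤ k →
    rowsK (k Data.Nat.∸ 1) (trim (boxes A)) ≡ rowsK k (boxes A)
lemma3p7 A (suc (suc m)) (s≤s (s≤s z≤n)) = rowsK-trim (boxes A) (boxes-columnConvex A) m
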